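{- For each recursive call of BronKerboschDelta with $R=(C,I)$ and $C=\{v_1,\dots,v_k\}\neq\emptyset$, it holds that $P \cup X = N^{\Delta}(v_1,I)\sqcap N^{\Delta}(v_2,I)\sqcap\cdots\sqcap N^{\Delta}(v_k,I)$, i.e., $P\cup X$ equals the iterated $\Delta$-cut of the $\Delta$-neighborhoods $N^{\Delta}(v,I)$ over all $v\in C$.
   Context: A temporal graph $\mathbb{G}=(V,E,T)$ has vertex set $V$, time-edges $E\subseteq\binom{V}{2}\times T$, and time interval $T=[\alpha,\omega]\subseteq\mathbb{N}$. A vertex-interval pair is a tuple $(v,I)$ with $v\in V$, $I\subseteq T$ an interval. For $v\in V$ and interval $I\subseteq T$, the $\Delta$-neighborhood $N^{\Delta}(v,I)$ is the set of all vertex-interval pairs $(w,I'=[a',b'])$ such that for every $\tau\in[a',b'-\Delta]$ there is an edge $(\{v,w\},t)\in E$ with $t\in[\tau,\tau+\Delta]$, $b'-a'\ge\Delta$, $I'\subseteq I$, and $I'$ is inclusion-maximal with these properties. For two sets $X,Y$ of vertex-interval pairs, the $\Delta$-cut is $X\sqcap Y=\{(v,I\cap I')\mid (v,I)\in X,\ (v,I')\in Y,\ |I\cap I'|\ge\Delta\}$. Algorithm BronKerboschDelta$(P,R=(C,I),X)$ (with $P,X$ sets of vertex-interval pairs, $C\subseteq V$, $I$ an interval): if every $(w,I')\in P\cup X$ satisfies $I'\subsetneq I$, output $R$; then for each $(v,I')\in P$: set $R'=(C\cup\{v\},I')$, $P'=P\sqcap N^{\Delta}(v,I')$, $X'=X\sqcap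 N^{\Delta}(v,I')$, recursively call BronKerboschDelta$(P',R',X')$, then remove $(v,I')$ from $P$ and add it to $X$. The initial call is with $P=\{(v,T)\mid v\in V\}$, $R=(\emptyset,T)$, $X=\emptyset$. -}

module Defs where

open import Data.Nat using (ℕ; _+_; _≤_; _⊔_; _⊓_)
open import Data.Fin using (Fin)
open import Data.Product using (Σ; ∃; _×_; _,_; proj₁; proj₂)
open import Data.Sum using (_⊎_)
open import Data.List using (List)
open import Data.List.Membership.Propositional using (_∈_)
open import Relation.Binary.PropositionalEquality using (_≡_; _≢_)
open import Relation.Nullary using (¬_)
open import Data.Empty using (⊥)

-- A temporal graph G = (V, E, T) with V = Fin n, T = [α, ω] and a finite list
-- of time-edges (u , w , t) standing for ({u , w} , t) with u ≠ w and t ∈ T.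
record TGraph : Set where
  field
    n      : ℕ
    α      : ℕ
    ω      : ℕ
    α≤ω    : α ≤ ω
    edges  : List (Fin n × Fin n × ℕ)
    noLoop : ∀ {u w t} → (u , w , t) ∈ edges → u ≢ w
    inT    : ∀ {u w t} → (u , w , t) ∈ edges → α ≤ t × t ≤ ω

open TGraph public

-- An interval [a , b] ⊆ ℕ is represented by the pair (a , b).
Interval : Set
Interval = ℕ × ℕ

lo hi : Interval → ℕ
lo = proj₁
hi = proj₂

-- I' ⊆ I  (for intervals [a',b'] , [a,b] with a' ≤ b')
_⊆I_ : Interval → Interval → Set
I' ⊆I I = lo I ≤ lo I' × hi I' ≤ hi I

_∩I_ : Interval → Interval → Interval
I ∩I I' = (lo I ⊔ lo I') , (hi I ⊓ hi I')

VIP : TGraph → Set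
VIP G = Fin (n G) × Interval

VIPSet : TGraph → Set₁
VIPSet G = VIP G → Set

VSet : TGraph → Set₁
VSet G = Fin (n G) → Set

module _ (G : TGraph) (Δ : ℕ) where

  HasEdge : Fin (n G) → Fin (n G) → ℕ → Set
  HasEdge v w t = ((v , w , t) ∈ edges G) ⊎ ((w , v , t) ∈ edges G)

  ΔAdj : Fin (n G) → Fin (n G) → Interval → Set
  ΔAdj v w I' =
    (∀ τ → lo I' ≤ τ → τ + Δ ≤ hi I' →
       ∃ λ t → HasEdge v w t × τ ≤ t × t ≤ τ + Δ)
    × lo I' + Δ ≤ hi I'

  N : Fin (n G) → Interval → VIPSet G
  N v I (w , I') =
    ΔAdj v w I' × I' ⊆I I
    × (∀ J → ΔAdj v w J → I' ⊆I J → J ⊆I I → J ≡ I')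

  _⊓Δ_ : VIPSet G → VIPSet G → VIPSet G
  (X ⊓Δ Y) (w , J) =
    Σ Interval λ I → Σ Interval λ I' →
      X (w , I) × Y (w , I') × J ≡ (I ∩I I') × lo (I ∩I I') + Δ ≤ hi (I ∩I I')

  iterCut : Fin (n G) → List (Fin (n G)) → Interval → VIPSet G
  iterCut v List.[] I = N v I
  iterCut v (u List.∷ us) I = N v I ⊓Δ iterCut u us I

  _∪S_ : VIPSet G → VIPSet G → VIPSet G
  (A ∪S B) x = A x ⊎ B x

  _∖S_ : VIPSet G → VIP G → VIPSet G
  (A ∖S p) x = A x × x ≢ p

  _∪S1_ : VIPSet G → VIP G → VIPSet G
  (A ∪S1 p) x = A x ⊎ x ≡ p

  _∪V_ : VSet G → Fin (n G) → VSet G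
  (C ∪V v) u = C u ⊎ u ≡ v

  -- Reachable states of BronKerboschDelta.
  -- Call P C I X  : BronKerboschDelta(P , R = (C , I) , X) is called.
  -- Loop P C I X  : inside a call with R = (C , I), the for-loop is at a point
  --                 where the current sets are P and X (elements of P are
  --                 processed in an arbitrary order).
  data Call : VIPSet G → VSet G → Interval → VIPSet G → Set₁
  data Loop : VIPSet G → VSet G → Interval → VIPSet G → Set₁

  data Call where
    initial : Call (λ { (v , I) → I ≡ (α G , ω G) }) (λ _ → ⊥) (α G , ω G) (λ _ → ⊥)
    recurse : ∀ {P C I X v I'} → Loop P C I X → P (v , I') →
              Call (P ⊓Δ N v I') (C ∪V v) I' (X ⊓Δ N v I')

  data Loop where
    enter : ∀ {P C I X} → Call P C I X → Loop P C I X
    step  : ∀ {P C I X v I'} → Loop P C I X → P (v , I') →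
            Loop (P ∖S (v , I')) C I (X ∪S1 (v , I'))

-- Replace the order-dependent iterated cut by an order-free object. Say J is shared by L
-- inside I if J ⊆ I, |J| ≥ Δ, and for every u ∈ L the interval J lies inside a maximal
-- Δ-adjacency interval of w with u within I. Two maximal Δ-adjacency intervals sharing a
-- subinterval of length ≥ Δ coincide, because their hull is again Δ-adjacent; hence the
-- iterated cut over any listing of L consists exactly of the inclusion-maximal shared
-- intervals. A recursive call cuts P ∪ X with N^Δ(v, I′) for some I′ ⊆ I: this restricts
-- every maximal interval K inside I to K ∩ I′, and every maximal interval inside I′ extends
-- to one inside I, so the maximal shared intervals of C in I become those of C ∪ {v} in I′.
-- Moving an element from P to X leaves P ∪ X unchanged.

module Submission where

open import Defs
open import Data.Nat using (ℕ; zero; suc; _+_; _≤_; _<_; _⊔_; _⊓_; _≤?_; z≤n; s≤s; s≤s⁻¹)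
open import Data.Nat.Properties
open import Data.Nat.Induction using (<-wellFounded)
open import Data.Fin using (Fin)
import Data.Fin as Fin
import Data.Nat as ℕ
open import Data.List using (List; []; _∷_)
open import Data.List.Relation.Unary.All using (All; []; _∷_)
import Data.List.Relation.Unary.All as All
open import Data.List.Relation.Unary.All.Properties using (anti-mono)
open import Data.List.Relation.Unary.Any using (here; there)
open import Data.List.Relation.Unary.Unique.Propositional using (Unique)
open import Data.List.Membership.Propositional using (_∈_)
open import Data.List.Relation.Binary.Subset.Propositional using (_⊆_)
import Data.List.Membership.DecPropositional as DecMembership
open import Data.Product using (∃; _×_; _,_; proj₁; proj₂)
open import Data.Product.Properties using (≡-dec)
open import Data.Sum using (_⊎_; inj₁; inj₂; [_,_])
import Data.Sum as Sum
open import Function.Bundles using (_⇔_; mk⇔; module Equivalence)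
open import Induction.WellFounded using (Acc; acc)
open import Relation.Binary.PropositionalEquality using (_≡_; refl; sym; trans; cong₂; subst)
open import Relation.Nullary using (¬_; Dec; yes; no; contradiction)
open import Relation.Nullary.Decidable using (map′; _×-dec_; _→-dec_; _⊎-dec_)
open import Relation.Unary using (Decidable; _≐_)
open import Relation.Unary.Properties using (≐-sym; ≐-trans)

⊆I-refl : ∀ {J} → J ⊆I J
⊆I-refl = ≤-refl , ≤-refl

⊆I-trans : ∀ {J K L} → J ⊆I K → K ⊆I L → J ⊆I L
⊆I-trans (lo₁ , hi₁) (lo₂ , hi₂) = ≤-trans lo₂ lo₁ , ≤-trans hi₁ hi₂

⊆I-antisym : ∀ {J K} → J ⊆I K → K ⊆I J → J ≡ K
⊆I-antisym (lo₁ , hi₁) (lo₂ , hi₂) = cong₂ _,_ (≤-antisym lo₂ lo₁) (≤-antisym hi₁ hi₂)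

∩I-⊆ˡ : ∀ J K → (J ∩I K) ⊆I J
∩I-⊆ˡ J K = m≤m⊔n (lo J) (lo K) , m⊓n≤m (hi J) (hi K)

∩I-⊆ʳ : ∀ J K → (J ∩I K) ⊆I K
∩I-⊆ʳ J K = m≤n⊔m (lo J) (lo K) , m⊓n≤n (hi J) (hi K)

⊆-∩I : ∀ {L J K} → L ⊆I J → L ⊆I K → L ⊆I (J ∩I K)
⊆-∩I (lo₁ , hi₁) (lo₂ , hi₂) = ⊔-lub lo₁ lo₂ , ⊓-glb hi₁ hi₂

∩I-comm : ∀ J K → J ∩I K ≡ K ∩I J
∩I-comm J K = cong₂ _,_ (⊔-comm (lo J) (lo K)) (⊓-comm (hi J) (hi K))

∩I-absorbs : ∀ {J K} → K ⊆I J → J ∩I K ≡ K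
∩I-absorbs {J} {K} K⊆J = ⊆I-antisym (∩I-⊆ʳ J K) (⊆-∩I K⊆J ⊆I-refl)

_∪I_ : Interval → Interval → Interval
J ∪I K = (lo J ⊓ lo K) , (hi J ⊔ hi K)

⊆-∪Iˡ : ∀ J K → J ⊆I (J ∪I K)
⊆-∪Iˡ J K = m⊓n≤m (lo J) (lo K) , m≤m⊔n (hi J) (hi K)

⊆-∪Iʳ : ∀ J K → K ⊆I (J ∪I K)
⊆-∪Iʳ J K = m⊓n≤n (lo J) (lo K) , m≤n⊔m (hi J) (hi K)

∪I-⊆ : ∀ {J K L} → J ⊆I L → K ⊆I L → (J ∪I K) ⊆I L
∪I-⊆ (lo₁ , hi₁) (lo₂ , hi₂) = ⊓-glb lo₁ lo₂ , ⊔-lub hi₁ hi₂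

m⊓n≤o⇒m≤o∨n≤o : ∀ m n {o} → m ⊓ n ≤ o → m ≤ o ⊎ n ≤ o
m⊓n≤o⇒m≤o∨n≤o m n m⊓n≤o = Sum.map (λ e → subst (_≤ _) e m⊓n≤o) (λ e → subst (_≤ _) e m⊓n≤o) (⊓-sel m n)

o≤m⊔n⇒o≤m∨o≤n : ∀ m n {o} → o ≤ m ⊔ n → o ≤ m ⊎ o ≤ n
o≤m⊔n⇒o≤m∨o≤n m n o≤m⊔n = Sum.map (λ e → subst (_ ≤_) e o≤m⊔n) (λ e → subst (_ ≤_) e o≤m⊔n) (⊔-sel m n)

module _ {Q : ℕ → Set} (Q? : Decidable Q) where

  least : ∀ {n} → Q n → ∃ λ a → a ≤ n × Q a × (∀ {k} → k < a → ¬ Q k)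
  least {n} = go n (<-wellFounded n)
    where
    go : ∀ n → Acc _<_ n → Q n → ∃ λ a → a ≤ n × Q a × (∀ {k} → k < a → ¬ Q k)
    go n (acc smaller) qn with anyUpTo? Q? n
    ... | no none = n , ≤-refl , qn , λ k<n qk → none (_ , k<n , qk)
    ... | yes (k , k<n , qk) with go k (smaller k<n) qk
    ...   | a , a≤k , qa , below = a , ≤-trans a≤k (<⇒≤ k<n) , qa , below

  greatest : ∀ {m} n → m ≤ n → Q m → ∃ λ b → m ≤ b × b ≤ n × Q b × (∀ {k} → b < k → k ≤ n → ¬ Q k)
  greatest n m≤n qm with Q? n
  greatest n m≤n qm | yes qn = n , m≤n , ≤-refl , qn , λ n<k k≤n _ → <⇒≱ n<k k≤n
  greatest zero z≤n qm | no ¬q = contradiction qm ¬q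
  greatest (suc n) m≤1+n qm | no ¬q with m≤n⇒m<n∨m≡n m≤1+n
  ... | inj₂ refl = contradiction qm ¬q
  ... | inj₁ m<1+n with greatest n (s≤s⁻¹ m<1+n) qm
  ...   | b , m≤b , b≤n , qb , above = b , m≤b , m≤n⇒m≤1+n b≤n , qb , above′
    where
    above′ : ∀ {k} → b < k → k ≤ suc n → ¬ Q k
    above′ b<k k≤1+n with m≤n⇒m<n∨m≡n k≤1+n
    ... | inj₁ k<1+n = above b<k (s≤s⁻¹ k<1+n)
    ... | inj₂ refl = ¬q

module _ (G : TGraph) (Δ : ℕ) where

  private
    V : Set
    V = Fin (n G)

  Long : Interval → Set
  Long J = lo J + Δ ≤ hi J

  Long-mono : ∀ {J K} → J ⊆I K → Long J → Long K
  Long-mono (lo≤ , ≤hi) long = ≤-trans (+-monoˡ-≤ Δ lo≤) (≤-trans long ≤hi)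

  ΔAdj-restrict : ∀ {v w J K} → ΔAdj G Δ v w K → J ⊆I K → Long J → ΔAdj G Δ v w J
  ΔAdj-restrict (windows , _) (lo≤ , ≤hi) long =
    (λ τ start end → windows τ (≤-trans lo≤ start) (≤-trans end ≤hi)) , long

  -- A window starting by lo J ends inside J ⊆ K₁ ∩ K₂; one starting after lo J starts inside both.
  ΔAdj-∪I : ∀ {v w J K₁ K₂} → ΔAdj G Δ v w K₁ → ΔAdj G Δ v w K₂ → J ⊆I K₁ → J ⊆I K₂ → Long J →
            ΔAdj G Δ v w (K₁ ∪I K₂)
  ΔAdj-∪I {v} {w} {J} {K₁} {K₂} (windows₁ , long₁) (windows₂ , _) (lo₁ , hi₁) (lo₂ , hi₂) longJ =
    windows , Long-mono (⊆-∪Iˡ K₁ K₂) long₁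
    where
    windows : ∀ τ → lo K₁ ⊓ lo K₂ ≤ τ → τ + Δ ≤ hi K₁ ⊔ hi K₂ →
              ∃ λ t → HasEdge G Δ v w t × τ ≤ t × t ≤ τ + Δ
    windows τ start end with τ ≤? lo J
    ... | yes τ≤loJ =
      [ (λ s → windows₁ τ s (≤-trans early hi₁)) , (λ s → windows₂ τ s (≤-trans early hi₂)) ]
        (m⊓n≤o⇒m≤o∨n≤o (lo K₁) (lo K₂) start)
      where
      early : τ + Δ ≤ hi J
      early = ≤-trans (+-monoˡ-≤ Δ τ≤loJ) longJ
    ... | no τ≰loJ =
      [ windows₁ τ (≤-trans lo₁ late) , windows₂ τ (≤-trans lo₂ late) ]
        (o≤m⊔n⇒o≤m∨o≤n (hi K₁) (hi K₂) end)
      where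
      late : lo J ≤ τ
      late = ≰⇒≥ τ≰loJ

  HasEdge? : ∀ v w t → Dec (HasEdge G Δ v w t)
  HasEdge? v w t = ((v , w , t) ∈? edges G) ⊎-dec ((w , v , t) ∈? edges G)
    where open DecMembership (≡-dec Fin._≟_ (≡-dec Fin._≟_ ℕ._≟_)) using (_∈?_)

  ΔAdj? : ∀ v w J → Dec (ΔAdj G Δ v w J)
  ΔAdj? v w J = map′ unbound bound (allUpTo? windowAt? (suc (hi J))) ×-dec (lo J + Δ ≤? hi J)
    where
    Window : ℕ → Set
    Window τ = ∃ λ t → HasEdge G Δ v w t × τ ≤ t × t ≤ τ + Δ
    window? : ∀ τ → Dec (Window τ)
    window? τ = map′ (λ (t , _ , e) → t , e) (λ (t , e) → t , s≤s (proj₂ (proj₂ e)) , e)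
                     (anyUpTo? (λ t → HasEdge? v w t ×-dec τ ≤? t ×-dec t ≤? τ + Δ) (suc (τ + Δ)))
    WindowAt : ℕ → Set
    WindowAt τ = lo J ≤ τ → τ + Δ ≤ hi J → Window τ
    windowAt? : ∀ τ → Dec (WindowAt τ)
    windowAt? τ = lo J ≤? τ →-dec (τ + Δ ≤? hi J →-dec window? τ)
    unbound : (∀ {τ} → τ < suc (hi J) → WindowAt τ) → ∀ τ → WindowAt τ
    unbound w τ start end = w (s≤s (≤-trans (m≤m+n τ Δ) end)) start end
    bound : (∀ τ → WindowAt τ) → ∀ {τ} → τ < suc (hi J) → WindowAt τ
    bound w {τ} _ = w τ

  N-unique : ∀ {v w I J K₁ K₂} → N G Δ v I (w , K₁) → N G Δ v I (w , K₂) →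
             J ⊆I K₁ → J ⊆I K₂ → Long J → K₁ ≡ K₂
  N-unique {v} {w} {I} {K₁ = K₁} {K₂} (adj₁ , K₁⊆I , max₁) (adj₂ , K₂⊆I , max₂) J⊆K₁ J⊆K₂ longJ =
    trans (sym (max₁ hull adjHull (⊆-∪Iˡ K₁ K₂) hull⊆I)) (max₂ hull adjHull (⊆-∪Iʳ K₁ K₂) hull⊆I)
    where
    hull : Interval
    hull = K₁ ∪I K₂
    adjHull : ΔAdj G Δ v w hull
    adjHull = ΔAdj-∪I adj₁ adj₂ J⊆K₁ J⊆K₂ longJ
    hull⊆I : hull ⊆I I
    hull⊆I = ∪I-⊆ K₁⊆I K₂⊆I

  N-shrink : ∀ {v w I I′ K} → N G Δ v I (w , K) → I′ ⊆I I → Long (K ∩I I′) →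
             N G Δ v I′ (w , K ∩I I′)
  N-shrink {v} {w} {I′ = I′} {K} (adjK , K⊆I , maxK) I′⊆I long =
    ΔAdj-restrict adjK (∩I-⊆ˡ K I′) long , ∩I-⊆ʳ K I′ , maximal
    where
    maximal : ∀ J → ΔAdj G Δ v w J → (K ∩I I′) ⊆I J → J ⊆I I′ → J ≡ K ∩I I′
    maximal J adjJ K∩I′⊆J J⊆I′ = ⊆I-antisym (⊆-∩I J⊆K J⊆I′) K∩I′⊆J
      where
      hull≡K : K ∪I J ≡ K
      hull≡K = maxK (K ∪I J) (ΔAdj-∪I adjK adjJ (∩I-⊆ˡ K I′) K∩I′⊆J long) (⊆-∪Iˡ K J)
                    (∪I-⊆ K⊆I (⊆I-trans J⊆I′ I′⊆I))
      J⊆K : J ⊆I K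
      J⊆K = subst (J ⊆I_) hull≡K (⊆-∪Iʳ K J)

  -- Take the leftmost start a keeping the end b₀, then the rightmost end b keeping the start a;
  -- a larger Δ-adjacent J would restrict to one at [lo J , b₀] or [a , hi J].
  N-extend : ∀ {v w I L} → ΔAdj G Δ v w L → L ⊆I I → ∃ λ K → N G Δ v I (w , K) × L ⊆I K
  N-extend {v} {w} {I} {a₀ , b₀} adj (lo≤a₀ , b₀≤hi)
    with least (λ a → lo I ≤? a ×-dec ΔAdj? v w (a , b₀)) (lo≤a₀ , adj)
  ... | a , a≤a₀ , (lo≤a , adjˡ) , leftmost
    with greatest (λ b → ΔAdj? v w (a , b)) (hi I) b₀≤hi adjˡ
  ... | b , b₀≤b , b≤hi , adjK , rightmost =
    (a , b) , (adjK , (lo≤a , b≤hi) , maximal) , (a≤a₀ , b₀≤b)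
    where
    maximal : ∀ J → ΔAdj G Δ v w J → (a , b) ⊆I J → J ⊆I I → J ≡ (a , b)
    maximal J adjJ (loJ≤a , b≤hiJ) (lo≤loJ , hiJ≤hi) = ⊆I-antisym (a≤loJ , hiJ≤b) (loJ≤a , b≤hiJ)
      where
      a≤loJ : a ≤ lo J
      a≤loJ = ≮⇒≥ λ loJ<a → leftmost loJ<a
        (lo≤loJ , ΔAdj-restrict adjJ (≤-refl , ≤-trans b₀≤b b≤hiJ)
                    (≤-trans (+-monoˡ-≤ Δ (≤-trans loJ≤a a≤a₀)) (proj₂ adj)))
      hiJ≤b : hi J ≤ b
      hiJ≤b = ≮⇒≥ λ b<hiJ → rightmost b<hiJ hiJ≤hi
        (ΔAdj-restrict adjJ (loJ≤a , ≤-refl) (≤-trans (proj₂ adjK) (<⇒≤ b<hiJ)))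

  InN : V → Interval → V → Interval → Set
  InN u I w J = ∃ λ K → N G Δ u I (w , K) × J ⊆I K

  Shared : List V → Interval → V → Interval → Set
  Shared L I w J = Long J × J ⊆I I × All (λ u → InN u I w J) L

  MaxShared : List V → Interval → VIPSet G
  MaxShared L I (w , J) = Shared L I w J × (∀ J′ → Shared L I w J′ → J ⊆I J′ → J′ ≡ J)

  InN-∪I : ∀ {u I w J J₁ J₂} → InN u I w J₁ → InN u I w J₂ → J ⊆I J₁ → J ⊆I J₂ → Long J →
           InN u I w (J₁ ∪I J₂)
  InN-∪I (K₁ , n₁ , J₁⊆K₁) (K₂ , n₂ , J₂⊆K₂) J⊆J₁ J⊆J₂ longJ =
    K₁ , n₁ , ∪I-⊆ J₁⊆K₁ (subst (_ ⊆I_) (sym K₁≡K₂) J₂⊆K₂)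
    where
    K₁≡K₂ : K₁ ≡ K₂
    K₁≡K₂ = N-unique n₁ n₂ (⊆I-trans J⊆J₁ J₁⊆K₁) (⊆I-trans J⊆J₂ J₂⊆K₂) longJ

  MaxShared-absorbs : ∀ {L I w J J′ J″} → MaxShared L I (w , J) → Shared L I w J′ →
                      J″ ⊆I J → J″ ⊆I J′ → Long J″ → J′ ⊆I J
  MaxShared-absorbs {L} {I} {w} {J} {J′} ((longJ , J⊆I , inJ) , maxJ) (_ , J′⊆I , inJ′) J″⊆J J″⊆J′ long =
    subst (J′ ⊆I_) (maxJ (J ∪I J′) sharedHull (⊆-∪Iˡ J J′)) (⊆-∪Iʳ J J′)
    where
    sharedHull : Shared L I w (J ∪I J′)
    sharedHull = Long-mono (⊆-∪Iˡ J J′) longJ , ∪I-⊆ J⊆I J′⊆I ,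
                 All.zipWith (λ (i , i′) → InN-∪I i i′ J″⊆J J″⊆J′ long) (inJ , inJ′)

  InN-restrict : ∀ {u I I′ w J J″} → InN u I w J → I′ ⊆I I → J″ ⊆I J → J″ ⊆I I′ → Long J″ → InN u I′ w J″
  InN-restrict {I′ = I′} {J″ = J″} (K , nK , J⊆K) I′⊆I J″⊆J J″⊆I′ long =
    K ∩I I′ , N-shrink nK I′⊆I (Long-mono J″⊆K∩I′ long) , J″⊆K∩I′
    where
    J″⊆K∩I′ : J″ ⊆I (K ∩I I′)
    J″⊆K∩I′ = ⊆-∩I (⊆I-trans J″⊆J J⊆K) J″⊆I′

  InN-lift : ∀ {u I I′ w J J′ J″} → InN u I w J → I′ ⊆I I → InN u I′ w J′ →
             J″ ⊆I J → J″ ⊆I J′ → Long J″ → InN u I w J′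
  InN-lift {I′ = I′} {J′ = J′} {J″} (K , nK , J⊆K) I′⊆I (K′ , nK′@(_ , K′⊆I′ , _) , J′⊆K′) J″⊆J J″⊆J′ long =
    K , nK , ⊆I-trans J′⊆K∩I′ (∩I-⊆ˡ K I′)
    where
    J″⊆K∩I′ : J″ ⊆I (K ∩I I′)
    J″⊆K∩I′ = ⊆-∩I (⊆I-trans J″⊆J J⊆K) (⊆I-trans J″⊆J′ (⊆I-trans J′⊆K′ K′⊆I′))
    K′≡K∩I′ : K′ ≡ K ∩I I′
    K′≡K∩I′ = N-unique nK′ (N-shrink nK I′⊆I (Long-mono J″⊆K∩I′ long)) (⊆I-trans J″⊆J′ J′⊆K′) J″⊆K∩I′ long
    J′⊆K∩I′ : J′ ⊆I (K ∩I I′)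
    J′⊆K∩I′ = subst (J′ ⊆I_) K′≡K∩I′ J′⊆K′

  InN-extend : ∀ {u I I′ w J} → I′ ⊆I I → InN u I′ w J → InN u I w J
  InN-extend I′⊆I (K′ , (adj , K′⊆I′ , _) , J⊆K′) =
    let K , nK , K′⊆K = N-extend adj (⊆I-trans K′⊆I′ I′⊆I) in K , nK , ⊆I-trans J⊆K′ K′⊆K

  N≐MaxShared-singleton : ∀ {v I} → N G Δ v I ≐ MaxShared (v ∷ []) I
  N≐MaxShared-singleton {v} {I} = to , from
    where
    to : ∀ {x} → N G Δ v I x → MaxShared (v ∷ []) I x
    to {w , J} nJ@((_ , longJ) , J⊆I , maxJ) = (longJ , J⊆I , (J , nJ , ⊆I-refl) ∷ []) , maximal
      where
      maximal : ∀ J′ → Shared (v ∷ []) I w J′ → J ⊆I J′ → J′ ≡ J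
      maximal J′ (_ , _ , (K′ , (adj′ , K′⊆I , _) , J′⊆K′) ∷ []) J⊆J′ =
        ⊆I-antisym (subst (J′ ⊆I_) (maxJ K′ adj′ (⊆I-trans J⊆J′ J′⊆K′) K′⊆I) J′⊆K′) J⊆J′
    from : ∀ {x} → MaxShared (v ∷ []) I x → N G Δ v I x
    from {w , J} ((_ , _ , (K , nK@((_ , longK) , K⊆I , _) , J⊆K) ∷ []) , maxJ) =
      subst (λ K → N G Δ v I (w , K)) (maxJ K (longK , K⊆I , (K , nK , ⊆I-refl) ∷ []) J⊆K) nK

  _⊓ᵟ_ : VIPSet G → VIPSet G → VIPSet G
  _⊓ᵟ_ = _⊓Δ_ G Δ

  N⊓MaxShared⊆MaxShared : ∀ {v L I I′ w K J} → I′ ⊆I I → N G Δ v I′ (w , K) → MaxShared L I (w , J) →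
                           Long (K ∩I J) → MaxShared (v ∷ L) I′ (w , K ∩I J)
  N⊓MaxShared⊆MaxShared {v} {L} {I} {I′} {w} {K} {J} I′⊆I nK@(_ , K⊆I′ , _) maxJ@((_ , _ , inJ) , _) long =
    (long , K∩J⊆I′ , (K , nK , ∩I-⊆ˡ K J) ∷ All.map restrict inJ) , maximal
    where
    K∩J⊆I′ : (K ∩I J) ⊆I I′
    K∩J⊆I′ = ⊆I-trans (∩I-⊆ˡ K J) K⊆I′
    restrict : ∀ {u} → InN u I w J → InN u I′ w (K ∩I J)
    restrict inJ = InN-restrict inJ I′⊆I (∩I-⊆ʳ K J) K∩J⊆I′ long
    maximal : ∀ J′ → Shared (v ∷ L) I′ w J′ → (K ∩I J) ⊆I J′ → J′ ≡ K ∩I J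
    maximal J′ (longJ′ , J′⊆I′ , (K′ , nK′ , J′⊆K′) ∷ inJ′) K∩J⊆J′ =
      ⊆I-antisym (⊆-∩I J′⊆K J′⊆J) K∩J⊆J′
      where
      J′⊆K : J′ ⊆I K
      J′⊆K = subst (J′ ⊆I_) (N-unique nK′ nK (⊆I-trans K∩J⊆J′ J′⊆K′) (∩I-⊆ˡ K J) long) J′⊆K′
      lift : ∀ {u} → InN u I w J × InN u I′ w J′ → InN u I w J′
      lift (i , i′) = InN-lift i I′⊆I i′ (∩I-⊆ʳ K J) K∩J⊆J′ long
      J′⊆J : J′ ⊆I J
      J′⊆J = MaxShared-absorbs maxJ (longJ′ , ⊆I-trans J′⊆I′ I′⊆I , All.zipWith lift (inJ , inJ′))
                               (∩I-⊆ʳ K J) K∩J⊆J′ long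

  MaxShared-cover : ∀ {L I w J} → Shared L I w J → ∃ λ J* → MaxShared L I (w , J*) × J ⊆I J*
  MaxShared-cover {[]} {I} (long , J⊆I , []) =
    I , ((Long-mono J⊆I long , ⊆I-refl , []) , λ J′ (_ , J′⊆I , _) I⊆J′ → ⊆I-antisym J′⊆I I⊆J′) , J⊆I
  MaxShared-cover {u ∷ L} {J = J} (long , J⊆I , (K , nK , J⊆K) ∷ inJ) with MaxShared-cover (long , J⊆I , inJ)
  ... | J₁ , maxJ₁ , J⊆J₁ =
    K ∩I J₁ , N⊓MaxShared⊆MaxShared ⊆I-refl nK maxJ₁ (Long-mono J⊆K∩J₁ long) , J⊆K∩J₁
    where
    J⊆K∩J₁ : J ⊆I (K ∩I J₁)
    J⊆K∩J₁ = ⊆-∩I J⊆K J⊆J₁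

  N⊓MaxShared≐MaxShared : ∀ {v L I I′} → I′ ⊆I I → (N G Δ v I′ ⊓ᵟ MaxShared L I) ≐ MaxShared (v ∷ L) I′
  N⊓MaxShared≐MaxShared {v} {L} {I} {I′} I′⊆I = to , from
    where
    to : ∀ {x} → (N G Δ v I′ ⊓ᵟ MaxShared L I) x → MaxShared (v ∷ L) I′ x
    to (K , J , nK , maxJ , refl , long) = N⊓MaxShared⊆MaxShared I′⊆I nK maxJ long
    from : ∀ {x} → MaxShared (v ∷ L) I′ x → (N G Δ v I′ ⊓ᵟ MaxShared L I) x
    from {w , J} ((long , J⊆I′ , (K , nK , J⊆K) ∷ inJ) , maxJ)
      with MaxShared-cover (long , ⊆I-trans J⊆I′ I′⊆I , All.map (InN-extend I′⊆I) inJ)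
    ... | J₁ , maxJ₁ , J⊆J₁ = K , J₁ , nK , maxJ₁ , sym K∩J₁≡J , subst Long (sym K∩J₁≡J) long
      where
      J⊆K∩J₁ : J ⊆I (K ∩I J₁)
      J⊆K∩J₁ = ⊆-∩I J⊆K J⊆J₁
      K∩J₁≡J : K ∩I J₁ ≡ J
      K∩J₁≡J = maxJ (K ∩I J₁) (proj₁ (N⊓MaxShared⊆MaxShared I′⊆I nK maxJ₁ (Long-mono J⊆K∩J₁ long))) J⊆K∩J₁

  MaxShared-cong : ∀ {L₁ L₂ I} → L₁ ⊆ L₂ → L₂ ⊆ L₁ → MaxShared L₁ I ≐ MaxShared L₂ I
  MaxShared-cong L₁⊆L₂ L₂⊆L₁ = transport L₁⊆L₂ L₂⊆L₁ , transport L₂⊆L₁ L₁⊆L₂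
    where
    Shared-anti-mono : ∀ {L L′ I w J} → L′ ⊆ L → Shared L I w J → Shared L′ I w J
    Shared-anti-mono L′⊆L (long , J⊆I , inJ) = long , J⊆I , anti-mono L′⊆L inJ
    transport : ∀ {L L′ I x} → L ⊆ L′ → L′ ⊆ L → MaxShared L I x → MaxShared L′ I x
    transport L⊆L′ L′⊆L (shared , maxJ) =
      Shared-anti-mono L′⊆L shared , λ J′ sharedJ′ → maxJ J′ (Shared-anti-mono L⊆L′ sharedJ′)

  ⊓ᵟ-comm : ∀ {A B} → (A ⊓ᵟ B) ≐ (B ⊓ᵟ A)
  ⊓ᵟ-comm {A} {B} = swap {A} {B} , swap {B} {A}
    where
    swap : ∀ {A B x} → (A ⊓ᵟ B) x → (B ⊓ᵟ A) x
    swap (J₁ , J₂ , a , b , refl , long) =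
      J₂ , J₁ , b , a , ∩I-comm J₁ J₂ , subst Long (∩I-comm J₁ J₂) long

  ⊓ᵟ-congʳ : ∀ {A B B′} → B ≐ B′ → (A ⊓ᵟ B) ≐ (A ⊓ᵟ B′)
  ⊓ᵟ-congʳ (B⊆B′ , B′⊆B) =
    (λ (J₁ , J₂ , a , b , eq , long) → J₁ , J₂ , a , B⊆B′ b , eq , long) ,
    (λ (J₁ , J₂ , a , b , eq , long) → J₁ , J₂ , a , B′⊆B b , eq , long)

  ⊓ᵟ-distribʳ-∪S : ∀ {A B C} → (_∪S_ G Δ A B ⊓ᵟ C) ≐ _∪S_ G Δ (A ⊓ᵟ C) (B ⊓ᵟ C)
  ⊓ᵟ-distribʳ-∪S = (λ { (J₁ , J₂ , inj₁ a , c , eq , long) → inj₁ (J₁ , J₂ , a , c , eq , long)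
                      ; (J₁ , J₂ , inj₂ b , c , eq , long) → inj₂ (J₁ , J₂ , b , c , eq , long) }) ,
                   [ (λ (J₁ , J₂ , a , c , eq , long) → J₁ , J₂ , inj₁ a , c , eq , long) ,
                     (λ (J₁ , J₂ , b , c , eq , long) → J₁ , J₂ , inj₂ b , c , eq , long) ]

  N⊓ᵟ-whole : ∀ {v I} → (N G Δ v I ⊓ᵟ (λ x → proj₂ x ≡ I)) ≐ N G Δ v I
  N⊓ᵟ-whole {v} {I} = to , from
    where
    to : ∀ {x} → (N G Δ v I ⊓ᵟ (λ x → proj₂ x ≡ I)) x → N G Δ v I x
    to {w , _} (K , _ , nK@(_ , K⊆I , _) , refl , refl , _) =
      subst (λ K′ → N G Δ v I (w , K′)) (sym (trans (∩I-comm K I) (∩I-absorbs K⊆I))) nK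
    from : ∀ {x} → N G Δ v I x → (N G Δ v I ⊓ᵟ (λ x → proj₂ x ≡ I)) x
    from {w , J} nJ@((_ , long) , J⊆I , _) = J , I , nJ , refl , sym J∩I≡J , subst Long (sym J∩I≡J) long
      where
      J∩I≡J : J ∩I I ≡ J
      J∩I≡J = trans (∩I-comm J I) (∩I-absorbs J⊆I)

  iterCut≐MaxShared : ∀ v vs I → iterCut G Δ v vs I ≐ MaxShared (v ∷ vs) I
  iterCut≐MaxShared v [] I = N≐MaxShared-singleton
  iterCut≐MaxShared v (u ∷ us) I = ≐-trans (⊓ᵟ-congʳ (iterCut≐MaxShared u us I)) (N⊓MaxShared≐MaxShared ⊆I-refl)

  ∪S-transfer : ∀ {P X : VIPSet G} {p} → P p → _∪S_ G Δ (_∖S_ G Δ P p) (_∪S1_ G Δ X p) ≐ _∪S_ G Δ P X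
  ∪S-transfer {P} {X} {p} Pp = to , from
    where
    to : ∀ {x} → _∪S_ G Δ (_∖S_ G Δ P p) (_∪S1_ G Δ X p) x → _∪S_ G Δ P X x
    to (inj₁ (Px , _)) = inj₁ Px
    to (inj₂ (inj₁ Xx)) = inj₂ Xx
    to (inj₂ (inj₂ refl)) = inj₁ Pp
    from : ∀ {x} → _∪S_ G Δ P X x → _∪S_ G Δ (_∖S_ G Δ P p) (_∪S1_ G Δ X p) x
    from {x} (inj₁ Px) with ≡-dec Fin._≟_ (≡-dec ℕ._≟_ ℕ._≟_) x p
    ... | yes x≡p = inj₂ (inj₂ x≡p)
    ... | no x≢p = inj₁ (Px , x≢p)
    from (inj₂ Xx) = inj₂ (inj₁ Xx)

  -- P ∪ X at a call with R = (C , I), where L lists C; at the initial call it is {(w , I)}.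
  Candidates : List V → Interval → VIPSet G
  Candidates [] I (_ , J) = J ≡ I
  Candidates (u ∷ L) I = MaxShared (u ∷ L) I

  ⊓ᵟ-of-∪S : ∀ {A B C D} → _∪S_ G Δ A B ≐ C → _∪S_ G Δ (A ⊓ᵟ D) (B ⊓ᵟ D) ≐ (D ⊓ᵟ C)
  ⊓ᵟ-of-∪S A∪B≐C = ≐-trans (≐-sym ⊓ᵟ-distribʳ-∪S) (≐-trans ⊓ᵟ-comm (⊓ᵟ-congʳ A∪B≐C))

  Candidates-recurse : ∀ {P X : VIPSet G} {L v I I′} → P (v , I′) → _∪S_ G Δ P X ≐ Candidates L I →
                       _∪S_ G Δ (P ⊓ᵟ N G Δ v I′) (X ⊓ᵟ N G Δ v I′) ≐ MaxShared (v ∷ L) I′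
  Candidates-recurse {L = []} Pv PX≐ with proj₁ PX≐ (inj₁ Pv)
  ... | refl = ≐-trans (⊓ᵟ-of-∪S PX≐) (≐-trans N⊓ᵟ-whole N≐MaxShared-singleton)
  Candidates-recurse {L = _ ∷ _} Pv PX≐ with proj₁ PX≐ (inj₁ Pv)
  ... | (_ , I′⊆I , _) , _ = ≐-trans (⊓ᵟ-of-∪S PX≐) (N⊓MaxShared≐MaxShared I′⊆I)

  ∷-∪V : ∀ {C : VSet G} {L v} → (∀ u → C u ⇔ u ∈ L) → ∀ u → _∪V_ G Δ C v u ⇔ u ∈ v ∷ L
  ∷-∪V C⇔L u = mk⇔ [ (λ c → there (Equivalence.to (C⇔L u) c)) , here ]
                   (λ { (here u≡v) → inj₂ u≡v ; (there u∈L) → inj₁ (Equivalence.from (C⇔L u) u∈L) })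

  Invariant : VIPSet G → VSet G → Interval → VIPSet G → Set
  Invariant P C I X = ∃ λ L → (∀ u → C u ⇔ u ∈ L) × _∪S_ G Δ P X ≐ Candidates L I

  mutual
    Call-invariant : ∀ {P C I X} → Call G Δ P C I X → Invariant P C I X
    Call-invariant initial = [] , (λ _ → mk⇔ (λ ()) (λ ())) , [ (λ eq → eq) , (λ ()) ] , inj₁
    Call-invariant (recurse loop Pv) with Loop-invariant loop
    ... | L , C⇔L , PX≐ = _ ∷ L , ∷-∪V C⇔L , Candidates-recurse Pv PX≐

    Loop-invariant : ∀ {P C I X} → Loop G Δ P C I X → Invariant P C I X
    Loop-invariant (enter call) = Call-invariant call
    Loop-invariant (step loop Pv) with Loop-invariant loop
    ... | L , C⇔L , PX≐ = L , C⇔L , ≐-trans (∪S-transfer Pv) PX≐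

lemma1 : (G : TGraph) (Δ : ℕ) (P : VIPSet G) (C : VSet G) (I : Interval) (X : VIPSet G) →
         Call G Δ P C I X →
         (v₁ : Fin (n G)) (vs : List (Fin (n G))) →
         Unique (v₁ ∷ vs) → (∀ u → C u ⇔ (u ∈ v₁ ∷ vs)) →
         ∀ x → (P x ⊎ X x) ⇔ iterCut G Δ v₁ vs I x
lemma1 G Δ P C I X call v₁ vs _ C⇔v₁∷vs x with Call-invariant G Δ call
... | [] , C⇔[] , _ = contradiction (Equivalence.to (C⇔[] v₁) (Equivalence.from (C⇔v₁∷vs v₁) (here refl))) λ ()
... | u ∷ L , C⇔u∷L , PX≐ = mk⇔ (proj₁ PX≐iterCut) (proj₂ PX≐iterCut)
  where
  u∷L⊆v₁∷vs : (u ∷ L) ⊆ (v₁ ∷ vs)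
  u∷L⊆v₁∷vs {w} w∈ = Equivalence.to (C⇔v₁∷vs w) (Equivalence.from (C⇔u∷L w) w∈)
  v₁∷vs⊆u∷L : (v₁ ∷ vs) ⊆ (u ∷ L)
  v₁∷vs⊆u∷L {w} w∈ = Equivalence.to (C⇔u∷L w) (Equivalence.from (C⇔v₁∷vs w) w∈)
  PX≐iterCut : _∪S_ G Δ P X ≐ iterCut G Δ v₁ vs I
  PX≐iterCut = ≐-trans PX≐ (≐-trans (MaxShared-cong G Δ u∷L⊆v₁∷vs v₁∷vs⊆u∷L) (≐-sym (iterCut≐MaxShared G Δ v₁ vs I)))
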